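{- Let $\mathbf M_1=(S,\mathcal I_1)$ and $\mathbf M_2=(S,\mathcal I_2)$ be matroids and let $I_1,I_2$ be inclusion-wise maximal common independent sets of $\mathbf M_1$ and $\mathbf M_2$. Let $\mathbf M_j'=(\mathbf M_j|(I_1\cup I_2))/(I_1\cap I_2)$ for $j=1,2$. Then both $I_1\setminus I_2$ and $I_2\setminus I_1$ are inclusion-wise maximal common independent sets of $\mathbf M_1'$ and $\mathbf M_2'$.
   Context: A common independent set is a set independent in both matroids. Restriction $\mathbf M|X$: matroid on $X$ with independent sets the independent sets of $\mathbf M$ contained in $X$. Contraction $\mathbf M/X$: matroid on the ground set minus $X$ in which $Y$ is independent iff $\mathbf M|X$ has a base $B$ with $Y\cup B$ independent in $\mathbf M$. -}

module Defs where

open import Level using (0ℓ)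
open import Data.Nat using (ℕ; _<_)
open import Data.Fin using (Fin)
open import Data.Fin.Subset using (Subset; ⊥; ⁅_⁆; _∈_; _∉_; _⊆_; _∪_; _∩_; _─_; ∣_∣)
open import Data.Product using (Σ; ∃; _×_; _,_)

-- Used to describe minors (restrictions/contractions) of matroids,
-- whose ground sets are subsets of the original ground set.
record SetSystem (n : ℕ) : Set₁ where
  field
    ground : Subset n
    Indep  : Subset n → Set

open SetSystem public

record Matroid (n : ℕ) : Set₁ where
  field
    indep      : Subset n → Set
    empty      : indep ⊥
    hereditary : ∀ {I J} → J ⊆ I → indep I → indep J
    augment    : ∀ {I J} → indep I → indep J → ∣ I ∣ < ∣ J ∣ →
                 ∃ λ x → x ∈ J × x ∉ I × indep (I ∪ ⁅ x ⁆)

open Matroid public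

sys : ∀ {n} → Matroid n → SetSystem n
sys {n} M = record { ground = Data.Fin.Subset.⊤ ; Indep = indep M }

_∣ʳ_ : ∀ {n} → SetSystem n → Subset n → SetSystem n
M ∣ʳ X = record { ground = X ; Indep = λ Y → Indep M Y × Y ⊆ X }

IsBase : ∀ {n} → SetSystem n → Subset n → Set
IsBase M B = Indep M B × (∀ C → B ⊆ C → Indep M C → C ⊆ B)

_/ᶜ_ : ∀ {n} → SetSystem n → Subset n → SetSystem n
M /ᶜ X = record
  { ground = ground M ─ X
  ; Indep  = λ Y → Y ⊆ (ground M ─ X) ×
                   Σ (Subset _) (λ B → IsBase (M ∣ʳ X) B × Indep M (Y ∪ B))
  }

CommonIndep : ∀ {n} → SetSystem n → SetSystem n → Subset n → Set
CommonIndep M₁ M₂ I = Indep M₁ I × Indep M₂ I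

MaxCommonIndep : ∀ {n} → SetSystem n → SetSystem n → Subset n → Set
MaxCommonIndep M₁ M₂ I =
  CommonIndep M₁ M₂ I × (∀ J → I ⊆ J → CommonIndep M₁ M₂ J → J ⊆ I)

minor : ∀ {n} → Matroid n → Subset n → Subset n → SetSystem n
minor M I₁ I₂ = (sys M ∣ʳ (I₁ ∪ I₂)) /ᶜ (I₁ ∩ I₂)

{-# OPTIONS --safe #-}
module Submission where

-- When K is independent, K is the only base of M|K, so J is independent in
-- (M|U)/K exactly when J ⊆ U ─ K and J ∪ K is independent.  For K = I₁ ∩ I₂
-- this makes I₁ ─ I₂ common independent in the minors, since its union with K
-- is I₁; and a common independent J ⊇ I₁ ─ I₂ of the minors gives a common
-- independent J ∪ K ⊇ I₁, which lies in I₁ by maximality, so J ⊆ I₁ ─ I₂.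

open import Defs
open import Data.Nat using (ℕ)
open import Data.Fin using (Fin)
open import Data.Fin.Subset using (Subset; _─_; _∈_; _∉_; _⊆_; _∪_; _∩_; inside; outside)
open import Data.Fin.Subset.Properties
  using ( x∈p∪q⁻; x∈p∪q⁺; x∈p∩q⁺; p⊆p∪q; q⊆p∪q; p∩q⊆p; p∩q⊆q; p─q⊆p; ∩-comm
        ; ⊆-reflexive; x∈p∧x∉q⇒x∈p─q )
open import Data.Product using (_×_; _,_; proj₁; proj₂)
import Data.Sum as Sum
open import Data.Vec using ([]; _∷_; there)
open import Function using (id; _∘_)
open import Relation.Binary.PropositionalEquality using (_≡_; refl; cong; sym; subst)

private
  variable
    n : ℕ

x∈p─q⇒x∉q : ∀ {x : Fin n} (p q : Subset n) → x ∈ p ─ q → x ∉ q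
x∈p─q⇒x∉q (_ ∷ p) (_ ∷ q) (there x∈p─q) (there x∈q) = x∈p─q⇒x∉q p q x∈p─q x∈q

p─q∪p∩q≡p : (p q : Subset n) → (p ─ q) ∪ (p ∩ q) ≡ p
p─q∪p∩q≡p []            []            = refl
p─q∪p∩q≡p (inside  ∷ p) (inside  ∷ q) = cong (inside ∷_) (p─q∪p∩q≡p p q)
p─q∪p∩q≡p (inside  ∷ p) (outside ∷ q) = cong (inside ∷_) (p─q∪p∩q≡p p q)
p─q∪p∩q≡p (outside ∷ p) (inside  ∷ q) = cong (outside ∷_) (p─q∪p∩q≡p p q)
p─q∪p∩q≡p (outside ∷ p) (outside ∷ q) = cong (outside ∷_) (p─q∪p∩q≡p p q)

∪-monoˡ-⊆ : {p q : Subset n} (r : Subset n) → p ⊆ q → p ∪ r ⊆ q ∪ r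
∪-monoˡ-⊆ {p = p} r p⊆q = x∈p∪q⁺ ∘ Sum.map p⊆q id ∘ x∈p∪q⁻ p r

∪-monoʳ-⊆ : (p : Subset n) {q r : Subset n} → q ⊆ r → p ∪ q ⊆ p ∪ r
∪-monoʳ-⊆ p {q} q⊆r = x∈p∪q⁺ ∘ Sum.map id q⊆r ∘ x∈p∪q⁻ p q

isBase-restrict-self : ∀ (N : SetSystem n) {K} → Indep N K → IsBase (N ∣ʳ K) K
isBase-restrict-self N indK = (indK , id) , λ _ _ → proj₂

isBase-restrict-⊇ : ∀ (N : SetSystem n) {K B} → Indep N K → IsBase (N ∣ʳ K) B → K ⊆ B
isBase-restrict-⊇ N indK ((_ , B⊆K) , maximal) = maximal _ B⊆K (indK , id)

module _ (M : Matroid n) {U K : Subset n} (K⊆U : K ⊆ U) where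

  contract-indep⁺ : ∀ {J} → J ⊆ U ─ K → indep M (J ∪ K) →
                    Indep ((sys M ∣ʳ U) /ᶜ K) J
  contract-indep⁺ {J} J⊆U─K indJ∪K =
    J⊆U─K ,
    K , isBase-restrict-self (sys M ∣ʳ U) (hereditary M (q⊆p∪q J K) indJ∪K , K⊆U) ,
    indJ∪K , J∪K⊆U
    where
    J∪K⊆U : J ∪ K ⊆ U
    J∪K⊆U = Sum.[ p─q⊆p U K ∘ J⊆U─K , K⊆U ] ∘ x∈p∪q⁻ J K

  contract-indep⁻ : ∀ {J} → indep M K → Indep ((sys M ∣ʳ U) /ᶜ K) J →
                    indep M (J ∪ K)
  contract-indep⁻ {J} indK (_ , B , isBaseB , indJ∪B , _) =
    hereditary M (∪-monoʳ-⊆ J K⊆B) indJ∪B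
    where
    K⊆B : K ⊆ B
    K⊆B = isBase-restrict-⊇ (sys M ∣ʳ U) (indK , K⊆U) isBaseB

module _ (M₁ M₂ : Matroid n) {A U : Subset n} (B : Subset n) where

  maxCommonIndep-─-contract :
    MaxCommonIndep (sys M₁) (sys M₂) A → A ⊆ U →
    MaxCommonIndep ((sys M₁ ∣ʳ U) /ᶜ (A ∩ B)) ((sys M₂ ∣ʳ U) /ᶜ (A ∩ B)) (A ─ B)
  maxCommonIndep-─-contract ((indA₁ , indA₂) , maximalA) A⊆U =
    (contracted M₁ indA₁ , contracted M₂ indA₂) , maximal
    where
    K⊆A : A ∩ B ⊆ A
    K⊆A = p∩q⊆p A B

    K⊆U : A ∩ B ⊆ U
    K⊆U = A⊆U ∘ K⊆A

    A─B⊆U─K : A ─ B ⊆ U ─ (A ∩ B)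
    A─B⊆U─K x∈A─B = x∈p∧x∉q⇒x∈p─q (A⊆U (p─q⊆p A B x∈A─B))
                      (x∈p─q⇒x∉q A B x∈A─B ∘ p∩q⊆q A B)

    contracted : ∀ M → indep M A → Indep ((sys M ∣ʳ U) /ᶜ (A ∩ B)) (A ─ B)
    contracted M indA = contract-indep⁺ M K⊆U A─B⊆U─K
      (subst (indep M) (sym (p─q∪p∩q≡p A B)) indA)

    maximal : ∀ J → A ─ B ⊆ J →
              CommonIndep ((sys M₁ ∣ʳ U) /ᶜ (A ∩ B)) ((sys M₂ ∣ʳ U) /ᶜ (A ∩ B)) J →
              J ⊆ A ─ B
    maximal J A─B⊆J (indJ₁ , indJ₂) {x} x∈J =
      x∈p∧x∉q⇒x∈p─q x∈A (λ x∈B → x∉K (x∈p∩q⁺ (x∈A , x∈B)))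
      where
      A⊆J∪K : A ⊆ J ∪ (A ∩ B)
      A⊆J∪K = ∪-monoˡ-⊆ (A ∩ B) A─B⊆J ∘ ⊆-reflexive (sym (p─q∪p∩q≡p A B))

      J∪K⊆A : J ∪ (A ∩ B) ⊆ A
      J∪K⊆A = maximalA (J ∪ (A ∩ B)) A⊆J∪K
        ( contract-indep⁻ M₁ K⊆U (hereditary M₁ K⊆A indA₁) indJ₁
        , contract-indep⁻ M₂ K⊆U (hereditary M₂ K⊆A indA₂) indJ₂ )

      x∈A : x ∈ A
      x∈A = J∪K⊆A (p⊆p∪q (A ∩ B) x∈J)

      x∉K : x ∉ A ∩ B
      x∉K = x∈p─q⇒x∉q U (A ∩ B) (proj₁ indJ₁ x∈J)

proposition2 : ∀ {n : ℕ} (M₁ M₂ : Matroid n) (I₁ I₂ : Subset n) →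
    MaxCommonIndep (sys M₁) (sys M₂) I₁ →
    MaxCommonIndep (sys M₁) (sys M₂) I₂ →
    MaxCommonIndep (minor M₁ I₁ I₂) (minor M₂ I₁ I₂) (I₁ ─ I₂) ×
    MaxCommonIndep (minor M₁ I₁ I₂) (minor M₂ I₁ I₂) (I₂ ─ I₁)
proposition2 M₁ M₂ I₁ I₂ maxI₁ maxI₂ =
  maxCommonIndep-─-contract M₁ M₂ I₂ maxI₁ (p⊆p∪q I₂) ,
  subst (λ K → MaxCommonIndep ((sys M₁ ∣ʳ (I₁ ∪ I₂)) /ᶜ K) ((sys M₂ ∣ʳ (I₁ ∪ I₂)) /ᶜ K)
                              (I₂ ─ I₁))
        (∩-comm I₂ I₁)
        (maxCommonIndep-─-contract M₁ M₂ I₁ maxI₂ (q⊆p∪q I₁ I₂))
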